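{- Let $\mathbf{C}$ and $\mathbf{D}$ be categories and let $F : \mathrm{Ob}(\mathbf{D}) \rightleftarrows \mathrm{Ob}(\mathbf{C}) : G$ be a pre-adjunction between $\mathbf{C}$ and $\mathbf{D}$, with $\Phi_{\mathcal{Y},\mathcal{X}} : \hom_\mathbf{C}(F(\mathcal{Y}), \mathcal{X}) \to \hom_\mathbf{D}(\mathcal{Y}, G(\mathcal{X}))$ the corresponding family of maps between hom-sets. If $\mathbf{C}$ has the Ramsey property, then $\mathbf{D}$ has the Ramsey property.
   Context: A $k$-coloring of a set $\mathcal{S}$ is a partition $\mathcal{S} = \Sigma_1 \cup \ldots \cup \Sigma_k$ into pairwise disjoint sets. For a category $\mathbf{C}$, an integer $k \ge 2$ and objects $\mathcal{A}, \mathcal{B}, \mathcal{C}$, write $\mathcal{C} \longrightarrow (\mathcal{B})^{\mathcal{A}}_k$ if for every $k$-coloring $\hom_\mathbf{C}(\mathcal{A}, \mathcal{C}) = \Sigma_1 \cup \ldots \cup \Sigma_k$ there are $i \in \{1,\ldots,k\}$ and $w \in \hom_\mathbf{C}(\mathcal{B}, \mathcal{C})$ with $w \cdot \hom_\mathbf{C}(\mathcal{A}, \mathcal{B}) \subseteq \Sigma_i$. A category $\mathbf{C}$ has the Ramsey property if for every integer $k \ge 2$ and all objects $\mathcal{A}, \mathcal{B}$ with $\hom_\mathbf{C}(\mathcal{A}, \mathcal{B}) \ne \varnothing$ there is an object $\mathcal{C}$ with $\mathcal{C} \longrightarrow (\mathcal{B})^{\mathcal{A}}_k$. A pre-adjunction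 between $\mathbf{C}$ and $\mathbf{D}$ is a pair of maps (not necessarily functors) $F : \mathrm{Ob}(\mathbf{D}) \to \mathrm{Ob}(\mathbf{C})$, $G : \mathrm{Ob}(\mathbf{C}) \to \mathrm{Ob}(\mathbf{D})$ together with a family of maps (not required to be natural or bijective) $\Phi_{\mathcal{Y},\mathcal{X}} : \hom_\mathbf{C}(F(\mathcal{Y}), \mathcal{X}) \to \hom_\mathbf{D}(\mathcal{Y}, G(\mathcal{X}))$, indexed by all pairs $(\mathcal{Y}, \mathcal{X}) \in \mathrm{Ob}(\mathbf{D}) \times \mathrm{Ob}(\mathbf{C})$ with $\hom_\mathbf{C}(F(\mathcal{Y}), \mathcal{X}) \ne \varnothing$, such that: for every $\mathcal{C} \in \mathrm{Ob}(\mathbf{C})$, all $\mathcal{D}, \mathcal{E} \in \mathrm{Ob}(\mathbf{D})$, every $u \in \hom_\mathbf{C}(F(\mathcal{D}), \mathcal{C})$ and every $f \in \hom_\mathbf{D}(\mathcal{E}, \mathcal{D})$ there is $v \in \hom_\mathbf{C}(F(\mathcal{E}), F(\mathcal{D}))$ with $\Phi_{\mathcal{D}, \mathcal{C}}(u) \cdot f = \Phi_{\mathcal{E}, \mathcal{C}}(u \cdot v)$. -}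

module Defs where

open import Level using (Level; _⊔_; suc)
open import Data.Nat using (ℕ; _≥_)
open import Data.Fin using (Fin)
open import Data.Product using (Σ; Σ-syntax; ∃; ∃-syntax; _×_)
open import Relation.Binary.PropositionalEquality using (_≡_)

-- A (locally small) category; hom-sets are types, equality of morphisms is _≡_.
-- Composition  g · f  means "first f, then g".
record Category (o ℓ : Level) : Set (Level.suc (o ⊔ ℓ)) where
  infixr 9 _·_
  field
    Obj   : Set o
    Hom   : Obj → Obj → Set ℓ
    id    : ∀ {A} → Hom A A
    _·_   : ∀ {A B C} → Hom B C → Hom A B → Hom A C
    assoc : ∀ {A B C D} (h : Hom C D) (g : Hom B C) (f : Hom A B) →
            (h · g) · f ≡ h · (g · f)
    identityˡ : ∀ {A B} (f : Hom A B) → id · f ≡ f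
    identityʳ : ∀ {A B} (f : Hom A B) → f · id ≡ f

open Category

-- A k-coloring of a set S: a partition into k pairwise disjoint (possibly empty)
-- classes Σ₁,…,Σ_k, represented by the function assigning each element its class.
Coloring : ∀ {a} → ℕ → Set a → Set a
Coloring k S = S → Fin k

Arrows : ∀ {o ℓ} (𝐂 : Category o ℓ) (k : ℕ) (𝒜 ℬ 𝒞 : Obj 𝐂) → Set ℓ
Arrows 𝐂 k 𝒜 ℬ 𝒞 =
  (χ : Coloring k (Hom 𝐂 𝒜 𝒞)) →
  Σ[ i ∈ Fin k ] Σ[ w ∈ Hom 𝐂 ℬ 𝒞 ] ((f : Hom 𝐂 𝒜 ℬ) → χ (_·_ 𝐂 w f) ≡ i)

-- Ramsey property (hom(𝒜,ℬ) ≠ ∅ is rendered as: a morphism 𝒜 → ℬ is given)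
RamseyProperty : ∀ {o ℓ} → Category o ℓ → Set (o ⊔ ℓ)
RamseyProperty 𝐂 =
  (k : ℕ) → k ≥ 2 → (𝒜 ℬ : Obj 𝐂) → Hom 𝐂 𝒜 ℬ →
  Σ[ 𝒞 ∈ Obj 𝐂 ] Arrows 𝐂 k 𝒜 ℬ 𝒞

-- Pre-adjunction between 𝐂 and 𝐃.  Φ is given on every hom-set
-- hom_𝐂(F 𝒴, 𝒳); on empty hom-sets this carries no information, so this is
-- equivalent to indexing only over pairs with nonempty hom-set.
record PreAdjunction {o ℓ o′ ℓ′} (𝐂 : Category o ℓ) (𝐃 : Category o′ ℓ′)
       : Set (o ⊔ ℓ ⊔ o′ ⊔ ℓ′) where
  field
    F : Obj 𝐃 → Obj 𝐂
    G : Obj 𝐂 → Obj 𝐃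
    Φ : (𝒴 : Obj 𝐃) (𝒳 : Obj 𝐂) → Hom 𝐂 (F 𝒴) 𝒳 → Hom 𝐃 𝒴 (G 𝒳)
    condition : (𝒞 : Obj 𝐂) (𝒟 ℰ : Obj 𝐃)
                (u : Hom 𝐂 (F 𝒟) 𝒞) (f : Hom 𝐃 ℰ 𝒟) →
                Σ[ v ∈ Hom 𝐂 (F ℰ) (F 𝒟) ]
                  (_·_ 𝐃 (Φ 𝒟 𝒞 u) f ≡ Φ ℰ 𝒞 (_·_ 𝐂 u v))

-- A colouring χ of hom_𝐃(𝒜, G 𝒞) pulls back along Φ to a colouring of
-- hom_𝐂(F 𝒜, 𝒞).  If w : F ℬ → 𝒞 is monochromatic for the pullback, then so is
-- Φ w : ℬ → G 𝒞 for χ, because the pre-adjunction condition rewrites each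
-- Φ w · f as Φ (w · v) for some v : F 𝒜 → F ℬ.  Applying the condition to the
-- identity of F ℬ also shows hom_𝐂(F 𝒜, F ℬ) ≠ ∅ whenever hom_𝐃(𝒜, ℬ) ≠ ∅.
module Submission where

open import Defs
open import Data.Product using (_,_; proj₁)
open import Relation.Binary.PropositionalEquality using (_≡_; cong; trans)

open Category

module PreAdjunctionProperties {o ℓ o′ ℓ′} {𝐂 : Category o ℓ} {𝐃 : Category o′ ℓ′}
                               (P : PreAdjunction 𝐂 𝐃) where
  open PreAdjunction P

  F-hom : ∀ {𝒜 ℬ} → Hom 𝐃 𝒜 ℬ → Hom 𝐂 (F 𝒜) (F ℬ)
  F-hom {𝒜} {ℬ} f = proj₁ (condition (F ℬ) ℬ 𝒜 (id 𝐂) f)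

  Arrows-G : ∀ {k 𝒜 ℬ 𝒞} → Arrows 𝐂 k (F 𝒜) (F ℬ) 𝒞 → Arrows 𝐃 k 𝒜 ℬ (G 𝒞)
  Arrows-G {𝒜 = 𝒜} {ℬ} {𝒞} arrows χ with arrows (λ u → χ (Φ 𝒜 𝒞 u))
  ... | i , w , monochromatic = i , Φ ℬ 𝒞 w , Φw-monochromatic
    where
    Φw-monochromatic : (f : Hom 𝐃 𝒜 ℬ) → χ (_·_ 𝐃 (Φ ℬ 𝒞 w) f) ≡ i
    Φw-monochromatic f with condition 𝒞 ℬ 𝒜 w f
    ... | v , Φw·f≡Φ[w·v] = trans (cong χ Φw·f≡Φ[w·v]) (monochromatic v)

theorem3p2 : ∀ {o ℓ o′ ℓ′} (𝐂 : Category o ℓ) (𝐃 : Category o′ ℓ′) →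
    PreAdjunction 𝐂 𝐃 → RamseyProperty 𝐂 → RamseyProperty 𝐃
theorem3p2 𝐂 𝐃 P ramsey k k≥2 𝒜 ℬ f =
  let 𝒞 , arrows = ramsey k k≥2 (F 𝒜) (F ℬ) (F-hom f) in G 𝒞 , Arrows-G arrows
  where open PreAdjunction P
        open PreAdjunctionProperties P
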